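{- Let $k\geq 2$ and $q\geq 3$ be integers and let $(F^{(k)}_{q,n})_{n\geq 2-k}$ be the sequence of $(q,k)$-generalized Fibonacci numbers. Let $(U_{q,n})_{n\geq1}$ be defined by $U_{q,1}=1$, $U_{q,2}=q$ and $U_{q,n}=(q+1)U_{q,n-1}-(q-1)U_{q,n-2}$ for $n\geq 3$, and let $(V_{q,n})_{n\geq 1}$ be defined by $V_{q,1}=1$, $V_{q,2}=q+1$ and $V_{q,n}=(q+1)V_{q,n-1}-(q-1)V_{q,n-2}$ for $n\geq 3$. Then \[ F^{(k)}_{q,n}=U_{q,n}\quad\text{for all } 1\leq n\leq k+1, \] and \[ F^{(k)}_{q,n}=U_{q,n}-\sum_{j=1}^{n-k-1}V_{q,j}F_{q,n-k-j}^{(k)}\quad\text{for all } n\geq k+2. \]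
   Context: For integers $q\geq 1$ and $k\geq 2$, the sequence of $(q,k)$-generalized Fibonacci numbers $(F^{(k)}_{q,n})_{n\geq 2-k}$ is defined by the initial conditions $F^{(k)}_{q,-(k-2)}=F^{(k)}_{q,-(k-3)}=\cdots=F^{(k)}_{q,0}=0$, $F^{(k)}_{q,1}=1$, and the recurrence $F_{q,n}^{(k)}=qF_{q,n-1}^{(k)}+F_{q,n-2}^{(k)}+\cdots+F_{q,n-k}^{(k)}$ for all $n\geq 2$. -}

module Defs where

open import Data.Nat using (ℕ; zero; suc; _+_; _*_; _∸_)
open import Data.List using (List; []; _∷_; take)
open import Data.Nat.ListAction using (sum)
open import Data.Integer as ℤ using (ℤ; +_)

-- window q k n : the list [F(n), F(n-1), ..., F(n-k+1), ...] of (q,k)-generalized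
-- Fibonacci numbers, most recent first, for n ≥ 0, where F(m) = 0 for m ≤ 0
-- (this covers the initial conditions F(2-k) = ... = F(0) = 0).
-- The list has length n + k; entries beyond index n are the zero initial values.
zeros : ℕ → List ℕ
zeros zero    = []
zeros (suc m) = 0 ∷ zeros m

window : ℕ → ℕ → ℕ → List ℕ
window q k zero    = zeros k
window q k (suc zero) = 1 ∷ zeros k
window q k (suc (suc n)) with window q k (suc n)
... | []     = []                                   -- impossible (length ≥ k ≥ 1)
... | x ∷ xs = (q * x + sum (take (k ∸ 1) xs)) ∷ x ∷ xs
  -- F(n+2) = q F(n+1) + F(n) + ... + F(n+2-k)

-- (q,k)-generalized Fibonacci number F^{(k)}_{q,n} for n ≥ 0 (F 0 = 0).
-- For 2 - k ≤ n ≤ 0 the value is 0 by definition; only indices n ≥ 0 are needed.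
F : ℕ → ℕ → ℕ → ℕ
F q k n with window q k n
... | []    = 0
... | x ∷ _ = x

-- U_{q,n} for n ≥ 1 (index 0 is a dummy value, never used).
-- U_{q,1} = 1, U_{q,2} = q, U_{q,n} = (q+1) U_{q,n-1} - (q-1) U_{q,n-2}.
U : ℕ → ℕ → ℤ
U q zero = + 0
U q (suc zero) = + 1
U q (suc (suc zero)) = + q
U q (suc (suc (suc n))) =
  (+ (q + 1)) ℤ.* U q (suc (suc n)) ℤ.- (+ (q ∸ 1)) ℤ.* U q (suc n)

V : ℕ → ℕ → ℤ
V q zero = + 0
V q (suc zero) = + 1
V q (suc (suc zero)) = + (q + 1)
V q (suc (suc (suc n))) =
  (+ (q + 1)) ℤ.* V q (suc (suc n)) ℤ.- (+ (q ∸ 1)) ℤ.* V q (suc n)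

sumFrom1 : ℕ → (ℕ → ℤ) → ℤ
sumFrom1 zero    f = + 0
sumFrom1 (suc m) f = sumFrom1 m f ℤ.+ f (suc m)

{-# OPTIONS --safe #-}
-- Subtracting two consecutive instances of the defining recurrence gives
-- F(m) = (q+1) F(m-1) - (q-1) F(m-2) - F(m-k-1): the recurrence of U and V,
-- perturbed by F(m-k-1).  The convolution C(m) = Σ_{j=1}^{m-1} V(j) F(m-j)
-- satisfies C(m+2) = (q+1) C(m+1) - (q-1) C(m) + F(m+1), so U(n) - C(n-k)
-- obeys the same perturbed recurrence with the same initial values as F(n).
-- Since C(m) = 0 for m ≤ 1, the correction vanishes for n ≤ k + 1.
module Submission where

open import Defs
open import Data.Nat using (ℕ; zero; suc; _+_; _*_; _∸_; _≤_; z≤n; s≤s)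
import Data.Nat.Properties as ℕ
open import Data.List using (List; []; _∷_; take)
open import Data.Nat.ListAction using (sum)
open import Data.Product using (_×_; _,_)
open import Data.Integer as ℤ using (ℤ; +_)
import Data.Integer.Properties as ℤ
import Data.Nat.Tactic.RingSolver as ℕ-Solver
import Data.Integer.Tactic.RingSolver as ℤ-Solver
open import Relation.Binary.PropositionalEquality
  using (_≡_; refl; sym; trans; cong; cong₂; module ≡-Reasoning)

lookup₀ : List ℕ → ℕ → ℕ
lookup₀ []       i       = 0
lookup₀ (x ∷ xs) zero    = x
lookup₀ (x ∷ xs) (suc i) = lookup₀ xs i

sum-take-suc : ∀ m xs → sum (take (suc m) xs) ≡ sum (take m xs) + lookup₀ xs m
sum-take-suc zero    []       = refl
sum-take-suc zero    (x ∷ xs) = ℕ.+-comm x 0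
sum-take-suc (suc m) []       = refl
sum-take-suc (suc m) (x ∷ xs) =
  trans (cong (λ s → x + s) (sum-take-suc m xs)) (sym (ℕ.+-assoc x _ _))

sum-take-slide : ∀ m x xs →
  sum (take (suc m) (x ∷ xs)) + lookup₀ xs m ≡ x + sum (take (suc m) xs)
sum-take-slide m x xs = begin
  x + sum (take m xs) + lookup₀ xs m    ≡⟨ ℕ.+-assoc x _ _ ⟩
  x + (sum (take m xs) + lookup₀ xs m)  ≡⟨ cong (λ s → x + s) (sum-take-suc m xs) ⟨
  x + sum (take (suc m) xs)             ∎
  where open ≡-Reasoning

lookup₀-zeros : ∀ m i → lookup₀ (zeros m) i ≡ 0
lookup₀-zeros zero    i       = refl
lookup₀-zeros (suc m) zero    = refl
lookup₀-zeros (suc m) (suc i) = lookup₀-zeros m i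

window-suc : ∀ q k n → window q k (suc n) ≡ F q k (suc n) ∷ window q k n
window-suc q k zero    = refl
window-suc q k (suc n) with window q k (suc n) | window-suc q k n
... | x ∷ xs | _ = refl

F-zero : ∀ q k → F q k 0 ≡ 0
F-zero q zero    = refl
F-zero q (suc k) = refl

lookup₀-window : ∀ q k n i → lookup₀ (window q k n) i ≡ F q k (n ∸ i)
lookup₀-window q k zero i rewrite ℕ.0∸n≡0 i = trans (lookup₀-zeros k i) (sym (F-zero q k))
lookup₀-window q k (suc n) i rewrite window-suc q k n with i
... | zero   = refl
... | suc i′ = lookup₀-window q k n i′

F-suc-suc : ∀ q k n →
  F q k (suc (suc n)) ≡ q * F q k (suc n) + sum (take (k ∸ 1) (window q k n))
F-suc-suc q k n with window q k (suc n) | window-suc q k n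
... | x ∷ xs | refl = refl

sum-take-zeros : ∀ m n → sum (take m (zeros n)) ≡ 0
sum-take-zeros zero    n       = refl
sum-take-zeros (suc m) zero    = refl
sum-take-zeros (suc m) (suc n) = sum-take-zeros m n

F-two : ∀ q k → F q k 2 ≡ q
F-two q k = begin
  F q k 2                               ≡⟨ F-suc-suc q k 0 ⟩
  q * 1 + sum (take (k ∸ 1) (zeros k))  ≡⟨ cong (λ s → q * 1 + s) (sum-take-zeros (k ∸ 1) k) ⟩
  q * 1 + 0                             ≡⟨ ℕ.+-identityʳ (q * 1) ⟩
  q * 1                                 ≡⟨ ℕ.*-identityʳ q ⟩
  q                                     ∎
  where open ≡-Reasoning

F-window-slide : ∀ q k′ n →
  sum (take (suc k′) (window q (suc (suc k′)) (suc n))) + F q (suc (suc k′)) (n ∸ k′)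
    ≡ F q (suc (suc k′)) (suc n) + sum (take (suc k′) (window q (suc (suc k′)) n))
F-window-slide q k′ n = begin
  sum (take (suc k′) (window q k (suc n))) + F q k (n ∸ k′)
    ≡⟨ cong (λ w → sum (take (suc k′) w) + F q k (n ∸ k′)) (window-suc q k n) ⟩
  sum (take (suc k′) (F q k (suc n) ∷ window q k n)) + F q k (n ∸ k′)
    ≡⟨ cong (λ y → sum (take (suc k′) (F q k (suc n) ∷ window q k n)) + y) (lookup₀-window q k n k′) ⟨
  sum (take (suc k′) (F q k (suc n) ∷ window q k n)) + lookup₀ (window q k n) k′
    ≡⟨ sum-take-slide k′ (F q k (suc n)) (window q k n) ⟩
  F q k (suc n) + sum (take (suc k′) (window q k n))
    ∎
  where open ≡-Reasoning
        k = suc (suc k′)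

eliminate-window-sums : ∀ p a b c s s′ x →
  a ≡ suc p * b + s′ → b ≡ suc p * c + s → s′ + x ≡ c + s → a + p * c + x ≡ (suc p + 1) * b
eliminate-window-sums p a b c s s′ x refl b≡ slide = begin
  (1 + p) * b + s′ + p * c + x     ≡⟨ ℕ-Solver.solve (p ∷ b ∷ c ∷ s′ ∷ x ∷ []) ⟩
  (1 + p) * b + p * c + (s′ + x)   ≡⟨ cong (λ y → (1 + p) * b + p * c + y) slide ⟩
  (1 + p) * b + p * c + (c + s)    ≡⟨ ℕ-Solver.solve (p ∷ b ∷ c ∷ s ∷ []) ⟩
  (1 + p) * b + ((1 + p) * c + s)  ≡⟨ cong (λ y → (1 + p) * b + y) b≡ ⟨
  (1 + p) * b + b                  ≡⟨ ℕ-Solver.solve (p ∷ b ∷ []) ⟩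
  (1 + p + 1) * b                  ∎
  where open ≡-Reasoning

pos-isolate : ∀ a m c x n b → a + m * c + x ≡ n * b →
  + a ≡ + n ℤ.* + b ℤ.- + m ℤ.* + c ℤ.- + x
pos-isolate a m c x n b eq = begin
  + a                                          ≡⟨ add-sub-cancel (+ a) (+ m ℤ.* + c) (+ x) ⟩
  + a ℤ.+ + m ℤ.* + c ℤ.+ + x ℤ.- + m ℤ.* + c ℤ.- + x
    ≡⟨ cong (λ y → y ℤ.+ + x ℤ.- + m ℤ.* + c ℤ.- + x)
            (trans (cong (λ y → + a ℤ.+ y) (sym (ℤ.pos-* m c))) (sym (ℤ.pos-+ a (m * c)))) ⟩
  + (a + m * c) ℤ.+ + x ℤ.- + m ℤ.* + c ℤ.- + x
    ≡⟨ cong (λ y → y ℤ.- + m ℤ.* + c ℤ.- + x) (sym (ℤ.pos-+ (a + m * c) x)) ⟩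
  + (a + m * c + x) ℤ.- + m ℤ.* + c ℤ.- + x   ≡⟨ cong (λ y → + y ℤ.- + m ℤ.* + c ℤ.- + x) eq ⟩
  + (n * b) ℤ.- + m ℤ.* + c ℤ.- + x           ≡⟨ cong (λ y → y ℤ.- + m ℤ.* + c ℤ.- + x) (ℤ.pos-* n b) ⟩
  + n ℤ.* + b ℤ.- + m ℤ.* + c ℤ.- + x         ∎
  where
  open ≡-Reasoning
  add-sub-cancel : ∀ (a u x : ℤ) → a ≡ a ℤ.+ u ℤ.+ x ℤ.- u ℤ.- x
  add-sub-cancel = ℤ-Solver.solve-∀

-- For k = 2 + k′ the subtracted term F(n ∸ k′) is F(m - k - 1) at m = n + 3.
F-recurrence : ∀ p k′ n → let f m = + F (suc p) (suc (suc k′)) m in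
  f (3 + n) ≡ + (suc p + 1) ℤ.* f (2 + n) ℤ.- + p ℤ.* f (1 + n) ℤ.- f (n ∸ k′)
F-recurrence p k′ n = pos-isolate _ p _ _ (suc p + 1) _
  (eliminate-window-sums p _ _ _ _ _ _
    (F-suc-suc q k (suc n)) (F-suc-suc q k n) (F-window-slide q k′ n))
  where q = suc p
        k = suc (suc k′)

sumFrom1-cong : ∀ m {g h : ℕ → ℤ} → (∀ j → g j ≡ h j) → sumFrom1 m g ≡ sumFrom1 m h
sumFrom1-cong zero    g≗h = refl
sumFrom1-cong (suc m) g≗h = cong₂ ℤ._+_ (sumFrom1-cong m g≗h) (g≗h (suc m))

sumFrom1-suc : ∀ m (g : ℕ → ℤ) → sumFrom1 (suc m) g ≡ g 1 ℤ.+ sumFrom1 m (λ j → g (suc j))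
sumFrom1-suc zero    g = ℤ.+-comm (+ 0) (g 1)
sumFrom1-suc (suc m) g = trans (cong (ℤ._+ g (2 + m)) (sumFrom1-suc m g)) (ℤ.+-assoc (g 1) _ _)

sumFrom1-linear : ∀ m (a b : ℤ) (g h : ℕ → ℤ) →
  sumFrom1 m (λ j → a ℤ.* g j ℤ.- b ℤ.* h j) ≡ a ℤ.* sumFrom1 m g ℤ.- b ℤ.* sumFrom1 m h
sumFrom1-linear zero    a b g h = ℤ-Solver.solve (a ∷ b ∷ [])
sumFrom1-linear (suc m) a b g h =
  trans (cong (ℤ._+ (a ℤ.* g (suc m) ℤ.- b ℤ.* h (suc m))) (sumFrom1-linear m a b g h))
        (regroup a b (sumFrom1 m g) (sumFrom1 m h) (g (suc m)) (h (suc m)))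
  where
  regroup : ∀ u v G H x y → u ℤ.* G ℤ.- v ℤ.* H ℤ.+ (u ℤ.* x ℤ.- v ℤ.* y) ≡ u ℤ.* (G ℤ.+ x) ℤ.- v ℤ.* (H ℤ.+ y)
  regroup = ℤ-Solver.solve-∀

module _ (q : ℕ) where
  private
    A B : ℤ
    A = + (q + 1)
    B = + (q ∸ 1)

  V-suc-suc : ∀ j → V q (2 + j) ≡ A ℤ.* V q (1 + j) ℤ.- B ℤ.* V q j
  V-suc-suc zero    = initial-terms A B
    where
    initial-terms : ∀ a b → a ≡ a ℤ.* + 1 ℤ.- b ℤ.* + 0
    initial-terms = ℤ-Solver.solve-∀
  V-suc-suc (suc j) = refl

  convV : (ℕ → ℤ) → ℕ → ℤ
  convV f m = sumFrom1 (m ∸ 1) (λ j → V q j ℤ.* f (m ∸ j))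

  convV-suc-suc : ∀ f m → convV f (2 + m) ≡ A ℤ.* convV f (1 + m) ℤ.- B ℤ.* convV f m ℤ.+ f (1 + m)
  convV-suc-suc f zero    = first-terms A B (f 1)
    where
    first-terms : ∀ a b x → + 0 ℤ.+ + 1 ℤ.* x ≡ a ℤ.* + 0 ℤ.- b ℤ.* + 0 ℤ.+ x
    first-terms = ℤ-Solver.solve-∀
  convV-suc-suc f (suc m) = begin
    convV f (3 + m)
      ≡⟨ sumFrom1-suc (suc m) _ ⟩
    V q 1 ℤ.* f (2 + m) ℤ.+ sumFrom1 (suc m) (λ j → V q (1 + j) ℤ.* f (2 + m ∸ j))
      ≡⟨ cong (λ z → V q 1 ℤ.* f (2 + m) ℤ.+ z) (sumFrom1-suc m _) ⟩
    V q 1 ℤ.* f (2 + m) ℤ.+ (V q 2 ℤ.* f (1 + m) ℤ.+ sumFrom1 m (λ j → V q (2 + j) ℤ.* f (1 + m ∸ j)))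
      ≡⟨ cong (λ z → V q 1 ℤ.* f (2 + m) ℤ.+ (V q 2 ℤ.* f (1 + m) ℤ.+ z)) tail-recurrence ⟩
    + 1 ℤ.* f (2 + m) ℤ.+ (A ℤ.* f (1 + m) ℤ.+ (A ℤ.* X ℤ.- B ℤ.* Y))
      ≡⟨ regroup A B X Y (f (1 + m)) (f (2 + m)) ⟩
    A ℤ.* (+ 1 ℤ.* f (1 + m) ℤ.+ X) ℤ.- B ℤ.* Y ℤ.+ f (2 + m)
      ≡⟨ cong (λ z → A ℤ.* z ℤ.- B ℤ.* Y ℤ.+ f (2 + m)) (sumFrom1-suc m _) ⟨
    A ℤ.* convV f (2 + m) ℤ.- B ℤ.* convV f (1 + m) ℤ.+ f (2 + m)
      ∎
    where
    open ≡-Reasoning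
    X Y : ℤ
    X = sumFrom1 m (λ j → V q (1 + j) ℤ.* f (1 + m ∸ j))
    Y = sumFrom1 m (λ j → V q j ℤ.* f (1 + m ∸ j))
    distrib : ∀ a b u v x → (a ℤ.* u ℤ.- b ℤ.* v) ℤ.* x ≡ a ℤ.* (u ℤ.* x) ℤ.- b ℤ.* (v ℤ.* x)
    distrib = ℤ-Solver.solve-∀
    regroup : ∀ a b x y u v → + 1 ℤ.* v ℤ.+ (a ℤ.* u ℤ.+ (a ℤ.* x ℤ.- b ℤ.* y))
                              ≡ a ℤ.* (+ 1 ℤ.* u ℤ.+ x) ℤ.- b ℤ.* y ℤ.+ v
    regroup = ℤ-Solver.solve-∀
    tail-recurrence : sumFrom1 m (λ j → V q (2 + j) ℤ.* f (1 + m ∸ j)) ≡ A ℤ.* X ℤ.- B ℤ.* Y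
    tail-recurrence = trans
      (sumFrom1-cong m (λ j → trans (cong (ℤ._* f (1 + m ∸ j)) (V-suc-suc j))
                                    (distrib A B (V q (1 + j)) (V q j) (f (1 + m ∸ j)))))
      (sumFrom1-linear m A B _ _)

  convV-≤1 : ∀ f {m} → m ≤ 1 → convV f m ≡ + 0
  convV-≤1 f z≤n       = refl
  convV-≤1 f (s≤s z≤n) = refl

  private
    vanishing : ∀ x → x ≡ + 0 → + 0 ≡ A ℤ.* + 0 ℤ.- B ℤ.* + 0 ℤ.+ x
    vanishing x refl = multiples-of-zero A B
      where
      multiples-of-zero : ∀ a b → + 0 ≡ a ℤ.* + 0 ℤ.- b ℤ.* + 0 ℤ.+ + 0
      multiples-of-zero = ℤ-Solver.solve-∀

  convV-suc-∸ : ∀ f → f 0 ≡ + 0 → ∀ n t →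
    convV f (suc n ∸ t) ≡ A ℤ.* convV f (n ∸ t) ℤ.- B ℤ.* convV f (n ∸ suc t) ℤ.+ f (n ∸ t)
  convV-suc-∸ f f0 zero    zero    = vanishing (f 0) f0
  convV-suc-∸ f f0 (suc n) zero    = convV-suc-suc f n
  convV-suc-∸ f f0 zero    (suc t) rewrite ℕ.0∸n≡0 t = vanishing (f 0) f0
  convV-suc-∸ f f0 (suc n) (suc t) = convV-suc-∸ f f0 n t

  U-minus-convV : ∀ k′ f → f 0 ≡ + 0 → f 1 ≡ + 1 → f 2 ≡ + q →
    (∀ n → f (3 + n) ≡ A ℤ.* f (2 + n) ℤ.- B ℤ.* f (1 + n) ℤ.- f (n ∸ k′)) →
    ∀ n → f n ≡ U q n ℤ.- convV f (n ∸ (2 + k′))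
  U-minus-convV k′ f f0 f1 f2 rec zero                = f0
  U-minus-convV k′ f f0 f1 f2 rec (suc zero)          = f1
  U-minus-convV k′ f f0 f1 f2 rec (suc (suc zero))    rewrite ℕ.0∸n≡0 k′ =
    trans f2 (sym (ℤ.+-identityʳ (+ q)))
  U-minus-convV k′ f f0 f1 f2 rec (suc (suc (suc n))) = begin
    f (3 + n)
      ≡⟨ rec n ⟩
    A ℤ.* f (2 + n) ℤ.- B ℤ.* f (1 + n) ℤ.- f (n ∸ k′)
      ≡⟨ cong₂ (λ a b → A ℤ.* a ℤ.- B ℤ.* b ℤ.- f (n ∸ k′)) (U-minus-convV k′ f f0 f1 f2 rec (suc (suc n)))
                                                            (U-minus-convV k′ f f0 f1 f2 rec (suc n)) ⟩
    A ℤ.* (U q (2 + n) ℤ.- convV f (n ∸ k′)) ℤ.- B ℤ.* (U q (1 + n) ℤ.- convV f (n ∸ suc k′))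
      ℤ.- f (n ∸ k′)
      ≡⟨ regroup A B (U q (2 + n)) (U q (1 + n)) (convV f (n ∸ k′)) (convV f (n ∸ suc k′)) (f (n ∸ k′)) ⟩
    U q (3 + n) ℤ.- (A ℤ.* convV f (n ∸ k′) ℤ.- B ℤ.* convV f (n ∸ suc k′) ℤ.+ f (n ∸ k′))
      ≡⟨ cong (λ c → U q (3 + n) ℤ.- c) (convV-suc-∸ f f0 n k′) ⟨
    U q (3 + n) ℤ.- convV f (suc n ∸ k′)
      ∎
    where
    open ≡-Reasoning
    regroup : ∀ a b u u′ c c′ x → a ℤ.* (u ℤ.- c) ℤ.- b ℤ.* (u′ ℤ.- c′) ℤ.- x
                                   ≡ (a ℤ.* u ℤ.- b ℤ.* u′) ℤ.- (a ℤ.* c ℤ.- b ℤ.* c′ ℤ.+ x)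
    regroup = ℤ-Solver.solve-∀

theorem3 : (k q : ℕ) → 2 ≤ k → 3 ≤ q →
    ((n : ℕ) → 1 ≤ n → n ≤ k + 1 → + (F q k n) ≡ U q n)
    × ((n : ℕ) → k + 2 ≤ n →
        + (F q k n) ≡ U q n ℤ.- sumFrom1 (n ∸ k ∸ 1) (λ j → V q j ℤ.* + (F q k (n ∸ k ∸ j))))
theorem3 k@(suc (suc k′)) q@(suc p) (s≤s (s≤s _)) (s≤s _) = initial , (λ n _ → F≡U-convV n)
  where
  f : ℕ → ℤ
  f n = + F q k n
  F≡U-convV : ∀ n → f n ≡ U q n ℤ.- convV q f (n ∸ k)
  F≡U-convV = U-minus-convV q k′ f (cong +_ (F-zero q k)) refl (cong +_ (F-two q k)) (F-recurrence p k′)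
  initial : (n : ℕ) → 1 ≤ n → n ≤ k + 1 → f n ≡ U q n
  initial n _ n≤k+1 = begin
    f n                           ≡⟨ F≡U-convV n ⟩
    U q n ℤ.- convV q f (n ∸ k)   ≡⟨ cong (λ c → U q n ℤ.- c) (convV-≤1 q f (ℕ.m≤n+o⇒m∸n≤o n k n≤k+1)) ⟩
    U q n ℤ.+ + 0                 ≡⟨ ℤ.+-identityʳ (U q n) ⟩
    U q n                         ∎
    where open ≡-Reasoning
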